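{- Let $s\ge1$, $0\le p\le r\le k$ and $n\ge sk$ be integers. Then \[ S^{(s)}_r(n,k)=\sum_{i=0}^{p}\frac{(k-r+p-i)!}{(k-r)!}\binom{p}{i}\binom{n-r}{i(s-1)}\frac{(i(s-1))!}{((s-1)!)^{i}}\,S^{(s)}_{r-p}\big(n-p-i(s-1),\,k-i\big). \]
   Context: Fix an integer $s\ge1$. For integers $n,k,r\ge0$, $S^{(s)}_r(n,k)$ is the number of partitions of $\{1,\dots,n\}$ into exactly $k$ nonempty blocks such that $1,\dots,r$ lie in pairwise distinct blocks and every block has at least $s$ elements. -}

module Defs where

open import Data.Bool using (Bool; true; false; _∧_; _∨_; not; if_then_else_)
open import Data.Nat using (ℕ; zero; suc; _≡ᵇ_; _<ᵇ_; _≤ᵇ_)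
open import Data.List using (List; []; _∷_; [_]; map; concatMap; upTo; length; filterᵇ; take)
open import Data.Bool.ListAction using (all; any)
open import Data.Nat.ListAction using (sum)

-- Encoding of set partitions of {1,…,n} into exactly k nonempty blocks:
-- restricted growth strings (RGS) w = (a₁,…,aₙ) with entries in {0,…,k-1},
-- where aⱼ is the label of the block containing j.  Blocks are labelled in
-- order of their smallest element: a₁ = 0 and each aⱼ is at most one more
-- than the largest earlier label; all k labels are used.

words : ℕ → ℕ → List (List ℕ)
words k zero    = [ [] ]
words k (suc n) = concatMap (λ w → map (λ c → c ∷ w) (upTo k)) (words k n)

isRGS : ℕ → List ℕ → ℕ → Bool
isRGS m []      k = m ≡ᵇ k
isRGS m (a ∷ w) k =
  ((a <ᵇ m) ∨ (a ≡ᵇ m)) ∧ isRGS (if a ≡ᵇ m then suc m else m) w k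

allDistinct : List ℕ → Bool
allDistinct []      = true
allDistinct (a ∷ w) = not (any (λ b → a ≡ᵇ b) w) ∧ allDistinct w

blockSize : ℕ → List ℕ → ℕ
blockSize c w = length (filterᵇ (λ b → c ≡ᵇ b) w)

-- the partition encoded by w satisfies the conditions defining S^{(s)}_r(n,k):
-- elements 1,…,r lie in pairwise distinct blocks, every block has ≥ s elements
good : ℕ → ℕ → ℕ → List ℕ → Bool
good s r k w =
  isRGS 0 w k ∧ allDistinct (take r w) ∧ all (λ c → s ≤ᵇ blockSize c w) (upTo k)

S : ℕ → ℕ → ℕ → ℕ → ℕ
S s r n k = length (filterᵇ (good s r k) (words k n))

sumTo : ℕ → (ℕ → ℕ) → ℕ
sumTo p f = sum (map f (upTo (suc p)))

-- Multiplying by (k - r)! names the k - r blocks not containing 1, …, r.  Since 1, …, r go to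
-- the blocks 0, …, r - 1, S⁽ˢ⁾ᵣ(n, k) · (k - r)! then counts the words of length n - r over k
-- letters (the blocks of r + 1, …, n) in which each of the first r letters occurs at least
-- s - 1 times and every other letter at least s times.  In such a count a letter needing t
-- occurs either at least t + 1 times or exactly t times, and in words of length L the latter
-- contributes (L choose t) times the count without that letter.  Applied to p of the letters needing
-- s - 1, this sorts the words by the number i of those letters with exactly s - 1 occurrences:
-- they are chosen in (p choose i) ways, their positions in
-- (n - r choose i(s-1)) · (i(s-1))! / ((s-1)!)^i ways, the other p - i letters now need s, and
-- forgetting the names of the k - r + p - i fresh letters gives back
-- S⁽ˢ⁾ᵣ₋ₚ(n - p - i(s-1), k - i) · (k - r + p - i)!.

module Submission where

open import Defs
open import Data.Nat using (ℕ; _+_; _*_; _∸_; _^_; _≤_; _/_; _!)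
open import Data.Nat.Properties using (_!≢0; m^n≢0)
open import Data.Nat.Combinatorics using (_C_)
open import Relation.Binary.PropositionalEquality using (_≡_)

open import Data.Bool using (Bool; true; false; _∧_; _∨_; not; if_then_else_)
open import Data.Bool.ListAction using (all; any; and)
open import Data.Bool.Properties using (∨-zeroʳ; ∨-identityʳ; ∧-zeroʳ)
open import Data.Empty using (⊥-elim)
open import Data.Fin using (Fin; zero; suc; toℕ; fromℕ<; punchIn; _↑ˡ_; _↑ʳ_)
open import Data.Fin.Permutation using (Permutation; _⟨$⟩ʳ_; _⟨$⟩ˡ_; inverseˡ; transpose; _∘ₚ_; cast-id)
open import Data.Fin.Properties
  using (toℕ-injective; toℕ<n; toℕ-↑ˡ; toℕ-↑ʳ; toℕ-inject₁; toℕ-fromℕ; toℕ-fromℕ<; toℕ-cast;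
         punchInᵢ≢i)
  renaming (_≟_ to _≟ᶠ_)
open import Data.List using (List; []; _∷_; [_]; _++_; map; concatMap; applyUpTo; upTo; take; length; filterᵇ)
open import Data.List.Properties using (map-++; map-cong; map-∘; ++-assoc; ++-identityʳ; applyUpTo-∷ʳ)
open import Data.Nat using (zero; suc; pred; _<_; _≡ᵇ_; _<ᵇ_; _≤ᵇ_; z≤n; s≤s)
open import Data.Nat.Combinatorics using (nCk+nC[k+1]≡[n+1]C[k+1]; k>n⇒nCk≡0; nCk≡n!/k![n-k]!; k![n∸k]!∣n!)
open import Data.Nat.Divisibility using (m≤n⇒m!∣n!)
open import Data.Nat.DivMod using (m/n*n≡m; m*n/n≡m)
open import Data.Nat.ListAction using (sum)
open import Data.Nat.ListAction.Properties using (sum-++)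
open import Data.Nat.Properties
  using (_≟_; _<?_; _≤?_; <-cmp; +-*-semiring; +-commutativeSemigroup; *-commutativeSemigroup; _!*_!≢0; m*n≢0;
         +-assoc; +-comm; +-identityʳ; +-suc; +-mono-≤; *-assoc; *-comm; *-identityʳ; *-distribʳ-+; *-distribˡ-+;
         *-monoˡ-≤; *-cancelʳ-≡; ≤-refl; ≤-trans; ≤-pred; <-≤-trans;
         <⇒≤; <⇒≢; >⇒≢; ≤⇒≯; ≰⇒>; ≤∧≢⇒<;
         n<1+n; n≤1+n; m<n⇒m≤1+n; m<m+n; m≤m+n; m≤n+m; 0≢1+n; suc-injective;
         +-∸-assoc; ∸-+-assoc; m+[n∸m]≡n; m∸n+n≡m; m+n∸n≡m; n∸n≡0; m+n≤o⇒m≤o∸n; pred[m∸n]≡m∸[1+n])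
open import Data.Nat.Tactic.RingSolver using (solve-∀)
open import Data.Vec.Functional as Vec using (Vector; updateAt)
open import Data.Vec.Functional.Properties using (updateAt-updates; updateAt-minimal)
open import Function using (_∘_)
open import Relation.Binary using (tri<; tri≈; tri>)
open import Relation.Binary.PropositionalEquality using (_≢_; refl; sym; trans; cong; cong₂; subst; module ≡-Reasoning)
open import Relation.Nullary using (yes; no)
open import Relation.Nullary.Decidable using (dec-true; dec-false)
open import Algebra.Properties.Semiring.Sum +-*-semiring
  using (sum-syntax; sum⁺-syntax; sum-cong-≗; ∑-distrib-+; *-distribˡ-sum; *-distribʳ-sum; ∑-permute;
         sum-remove; sum-replicate-zero; sum-init-last)
  renaming (sum to ∑)
open import Algebra.Properties.CommutativeSemigroup +-commutativeSemigroup
  using () renaming (x∙yz≈y∙xz to x+[y+z]≡y+[x+z]; x∙yz≈xz∙y to x+[y+z]≡[x+z]+y; xy∙z≈xz∙y to [x+y]+z≡[x+z]+y)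
open import Algebra.Properties.CommutativeSemigroup *-commutativeSemigroup
  using () renaming (x∙yz≈y∙xz to x*[y*z]≡y*[x*z])
open ≡-Reasoning

-- Finite sums

∑-cong : ∀ {n} {f g : Fin n → ℕ} → (∀ i → f i ≡ g i) → ∑[ i < n ] f i ≡ ∑[ i < n ] g i
∑-cong {f = f} {g} = sum-cong-≗ {x = f} {y = g}

∑-split : ∀ m {n} (f : Fin (m + n) → ℕ) →
          ∑[ i < m + n ] f i ≡ ∑[ i < m ] f (i ↑ˡ n) + ∑[ i < n ] f (m ↑ʳ i)
∑-split zero    f = refl
∑-split (suc m) f = trans (cong (f zero +_) (∑-split m (λ i → f (suc i)))) (sym (+-assoc (f zero) _ _))

∑-const : ∀ n x → ∑[ i < n ] x ≡ n * x
∑-const zero    x = refl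
∑-const (suc n) x = cong (x +_) (∑-const n x)

∑-last : ∀ n (f : ℕ → ℕ) → ∑[ i < suc n ] f (toℕ i) ≡ ∑[ i < n ] f (toℕ i) + f n
∑-last n f = trans (sum-init-last {n} (λ i → f (toℕ i)))
  (cong₂ _+_ (∑-cong {n} (λ i → cong f (toℕ-inject₁ i))) (cong f (toℕ-fromℕ n)))

∑-single : ∀ {n} (f : Fin n → ℕ) i → (∀ j → j ≢ i → f j ≡ 0) → ∑[ j < n ] f j ≡ f i
∑-single {suc n} f i others-zero = begin
  ∑[ j < suc n ] f j                       ≡⟨ sum-remove {i = i} f ⟩
  f i + ∑[ j < n ] f (punchIn i j)         ≡⟨ cong (f i +_) (∑-cong {n} (λ j → others-zero _ (punchInᵢ≢i i j))) ⟩
  f i + ∑[ j < n ] 0                       ≡⟨ cong (f i +_) (sum-replicate-zero n) ⟩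
  f i + 0                                  ≡⟨ +-identityʳ (f i) ⟩
  f i                                      ∎

∑≡ᵇ0-false : ∀ {n} (f : Fin n → ℕ) i {x} → f i ≡ suc x → (∑[ j < n ] f j ≡ᵇ 0) ≡ false
∑≡ᵇ0-false {suc n} f i fi≡1+x rewrite sum-remove {i = i} f | fi≡1+x = refl

∑-pascal : ∀ p (g : ℕ → ℕ) →
           ∑[ i ≤ suc p ] ((suc p C toℕ i) * g (toℕ i)) ≡ ∑[ i ≤ p ] ((p C toℕ i) * (g (toℕ i) + g (suc (toℕ i))))
∑-pascal p g = begin
  1 * g 0 + ∑[ i ≤ p ] ((suc p C suc (toℕ i)) * g (suc (toℕ i)))
    ≡⟨ cong (1 * g 0 +_) (∑-cong {suc p} pascal) ⟩
  1 * g 0 + ∑[ i ≤ p ] (up i + shift i)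
    ≡⟨ cong (1 * g 0 +_) (∑-distrib-+ {suc p} up shift) ⟩
  1 * g 0 + (∑[ i ≤ p ] up i + ∑[ i ≤ p ] shift i)
    ≡⟨ x+[y+z]≡[x+z]+y (1 * g 0) (∑[ i ≤ p ] up i) (∑[ i ≤ p ] shift i) ⟩
  (1 * g 0 + ∑[ i ≤ p ] shift i) + ∑[ i ≤ p ] up i
    ≡⟨ cong (_+ ∑[ i ≤ p ] up i) unshift ⟩
  ∑[ i ≤ p ] low i + ∑[ i ≤ p ] up i
    ≡⟨ ∑-distrib-+ {suc p} low up ⟨
  ∑[ i ≤ p ] (low i + up i)
    ≡⟨ ∑-cong {suc p} (λ i → *-distribˡ-+ (p C toℕ i) (g (toℕ i)) (g (suc (toℕ i)))) ⟨
  ∑[ i ≤ p ] ((p C toℕ i) * (g (toℕ i) + g (suc (toℕ i)))) ∎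
  where
  low up shift : Fin (suc p) → ℕ
  low   i = (p C toℕ i) * g (toℕ i)
  up    i = (p C toℕ i) * g (suc (toℕ i))
  shift i = (p C suc (toℕ i)) * g (suc (toℕ i))
  pascal : ∀ i → (suc p C suc (toℕ i)) * g (suc (toℕ i)) ≡ up i + shift i
  pascal i = trans (cong (_* g (suc (toℕ i))) (sym (nCk+nC[k+1]≡[n+1]C[k+1] p (toℕ i))))
                   (*-distribʳ-+ (g (suc (toℕ i))) (p C toℕ i) _)
  unshift : 1 * g 0 + ∑[ i ≤ p ] shift i ≡ ∑[ i ≤ p ] low i
  unshift = cong (1 * g 0 +_) (begin
    ∑[ i ≤ p ] shift i
      ≡⟨ ∑-last p (λ i → (p C suc i) * g (suc i)) ⟩
    ∑[ i < p ] ((p C suc (toℕ i)) * g (suc (toℕ i))) + (p C suc p) * g (suc p)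
      ≡⟨ cong (λ c → ∑[ i < p ] ((p C suc (toℕ i)) * g (suc (toℕ i))) + c * g (suc p)) (k>n⇒nCk≡0 (n<1+n p)) ⟩
    ∑[ i < p ] ((p C suc (toℕ i)) * g (suc (toℕ i))) + 0
      ≡⟨ +-identityʳ _ ⟩
    ∑[ i < p ] ((p C suc (toℕ i)) * g (suc (toℕ i))) ∎)

sum-map-applyUpTo : ∀ {A : Set} (g : A → ℕ) (h : ℕ → A) n →
                    sum (map g (applyUpTo h n)) ≡ ∑[ i < n ] g (h (toℕ i))
sum-map-applyUpTo g h zero    = refl
sum-map-applyUpTo g h (suc n) = cong (g (h 0) +_) (sum-map-applyUpTo g (λ i → h (suc i)) n)

sum-map-concatMap : ∀ {A B : Set} (f : B → ℕ) (g : A → List B) xs →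
                    sum (map f (concatMap g xs)) ≡ sum (map (λ x → sum (map f (g x))) xs)
sum-map-concatMap f g []       = refl
sum-map-concatMap f g (x ∷ xs) = begin
  sum (map f (g x ++ concatMap g xs))               ≡⟨ cong sum (map-++ f (g x) (concatMap g xs)) ⟩
  sum (map f (g x) ++ map f (concatMap g xs))       ≡⟨ sum-++ (map f (g x)) _ ⟩
  sum (map f (g x)) + sum (map f (concatMap g xs))  ≡⟨ cong (sum (map f (g x)) +_) (sum-map-concatMap f g xs) ⟩
  sum (map f (g x)) + sum (map (λ x → sum (map f (g x))) xs) ∎

sum-map-∑ : ∀ {A : Set} n (F : Fin n → A → ℕ) xs →
            sum (map (λ x → ∑[ i < n ] F i x) xs) ≡ ∑[ i < n ] sum (map (F i) xs)
sum-map-∑ n F []       = sym (sum-replicate-zero n)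
sum-map-∑ n F (x ∷ xs) = trans (cong (∑[ i < n ] F i x +_) (sum-map-∑ n F xs))
                               (sym (∑-distrib-+ {n} (λ i → F i x) (λ i → sum (map (F i) xs))))

sumTo-∑ : ∀ p f → sumTo p f ≡ ∑[ i ≤ p ] f (toℕ i)
sumTo-∑ p f = sum-map-applyUpTo f (λ i → i) (suc p)

-- Counting words

𝟙 : Bool → ℕ
𝟙 b = if b then 1 else 0

length-filterᵇ : ∀ {A : Set} (P : A → Bool) xs → length (filterᵇ P xs) ≡ sum (map (λ x → 𝟙 (P x)) xs)
length-filterᵇ P []       = refl
length-filterᵇ P (x ∷ xs) with P x
... | true  = cong suc (length-filterᵇ P xs)
... | false = length-filterᵇ P xs

count : ℕ → ℕ → (List ℕ → ℕ) → ℕ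
count k L f = sum (map f (words k L))

S≡count : ∀ s r n k → S s r n k ≡ count k n (λ w → 𝟙 (good s r k w))
S≡count s r n k = length-filterᵇ (good s r k) (words k n)

count-cong : ∀ k L {f g : List ℕ → ℕ} → (∀ w → f w ≡ g w) → count k L f ≡ count k L g
count-cong k L f≗g = cong sum (map-cong f≗g (words k L))

count-zero : ∀ k L → count k L (λ _ → 0) ≡ 0
count-zero k L = go (words k L)
  where
  go : ∀ ws → sum (map (λ _ → 0) ws) ≡ 0
  go []       = refl
  go (w ∷ ws) = go ws

count-∷ : ∀ k L f → count k (suc L) f ≡ ∑[ c < k ] count k L (λ w → f (toℕ c ∷ w))
count-∷ k L f = begin
  sum (map f (concatMap (λ w → map (_∷ w) (upTo k)) (words k L)))
    ≡⟨ sum-map-concatMap f _ (words k L) ⟩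
  sum (map (λ w → sum (map f (map (_∷ w) (upTo k)))) (words k L))
    ≡⟨ cong sum (map-cong first-letters (words k L)) ⟩
  sum (map (λ w → ∑[ c < k ] f (toℕ c ∷ w)) (words k L))
    ≡⟨ sum-map-∑ k (λ c w → f (toℕ c ∷ w)) (words k L) ⟩
  ∑[ c < k ] count k L (λ w → f (toℕ c ∷ w)) ∎
  where
  first-letters : ∀ w → sum (map f (map (_∷ w) (upTo k))) ≡ ∑[ c < k ] f (toℕ c ∷ w)
  first-letters w = trans (cong sum (sym (map-∘ (upTo k)))) (sum-map-applyUpTo (λ c → f (c ∷ w)) (λ c → c) k)

-- Restricted growth strings

<ᵇ-true : ∀ {m n} → m < n → (m <ᵇ n) ≡ true
<ᵇ-true {m} {n} = dec-true (m <? n)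

<ᵇ-false : ∀ {m n} → n ≤ m → (m <ᵇ n) ≡ false
<ᵇ-false {m} {n} n≤m = dec-false (m <? n) (≤⇒≯ n≤m)

≡ᵇ-refl : ∀ m → (m ≡ᵇ m) ≡ true
≡ᵇ-refl m = dec-true (m ≟ m) refl

≡ᵇ-false : ∀ {m n} → m ≢ n → (m ≡ᵇ n) ≡ false
≡ᵇ-false {m} {n} = dec-false (m ≟ n)

<ᵇ-suc : ∀ m n → (m <ᵇ suc n) ≡ ((m <ᵇ n) ∨ (m ≡ᵇ n))
<ᵇ-suc zero    zero    = refl
<ᵇ-suc zero    (suc n) = refl
<ᵇ-suc (suc m) zero    = refl
<ᵇ-suc (suc m) (suc n) = <ᵇ-suc m n

≤ᵇ-suc : ∀ m n → (m ≤ᵇ suc n) ≡ (pred m ≤ᵇ n)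
≤ᵇ-suc zero          n = refl
≤ᵇ-suc (suc zero)    n = refl
≤ᵇ-suc (suc (suc m)) n = refl

decAt : (ℕ → ℕ) → ℕ → ℕ → ℕ
decAt ν a x = if x ≡ᵇ a then pred (ν x) else ν x

meets : ℕ → (ℕ → ℕ) → List ℕ → Bool
meets k ν w = all (λ c → ν c ≤ᵇ blockSize c w) (upTo k)

meets-cong : ∀ k {ν μ : ℕ → ℕ} → (∀ x → ν x ≡ μ x) → ∀ w → meets k ν w ≡ meets k μ w
meets-cong k ν≗μ w = cong and (map-cong (λ c → cong (_≤ᵇ blockSize c w) (ν≗μ c)) (upTo k))

meets-∷ : ∀ k ν a w → meets k ν (a ∷ w) ≡ meets k (decAt ν a) w
meets-∷ k ν a w = cong and (map-cong lower (upTo k))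
  where
  lower : ∀ c → (ν c ≤ᵇ blockSize c (a ∷ w)) ≡ (decAt ν a c ≤ᵇ blockSize c w)
  lower c with c ≡ᵇ a
  ... | true  = ≤ᵇ-suc (ν c) (blockSize c w)
  ... | false = refl

meets-[] : ∀ k ν → meets k ν [] ≡ (∑[ i < k ] ν (toℕ i) ≡ᵇ 0)
meets-[] k ν = go (λ c → c) k
  where
  go : ∀ h n → all (λ c → ν c ≤ᵇ 0) (applyUpTo h n) ≡ (∑[ i < n ] ν (h (toℕ i)) ≡ᵇ 0)
  go h zero = refl
  go h (suc n) with ν (h 0)
  ... | zero  = go (λ i → h (suc i)) n
  ... | suc _ = refl

isRGS-old : ∀ {a m} k w → a < m → isRGS m (a ∷ w) k ≡ isRGS m w k
isRGS-old {a} {m} k w a<m rewrite <ᵇ-true a<m | ≡ᵇ-false (<⇒≢ a<m) = refl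

isRGS-new : ∀ m k w → isRGS m (m ∷ w) k ≡ isRGS (suc m) w k
isRGS-new m k w rewrite <ᵇ-false {m} {m} ≤-refl | ≡ᵇ-refl m = refl

isRGS-skip : ∀ {a m} k w → m < a → isRGS m (a ∷ w) k ≡ false
isRGS-skip {a} {m} k w m<a rewrite <ᵇ-false (<⇒≤ m<a) | ≡ᵇ-false (>⇒≢ m<a) = refl

rgsCount : ℕ → ℕ → (ℕ → ℕ) → ℕ → ℕ
rgsCount k m ν L = count k L (λ w → 𝟙 (isRGS m w k ∧ meets k ν w))

rgsCount-old : ∀ k {a m} ν L → a < m →
               count k L (λ w → 𝟙 (isRGS m (a ∷ w) k ∧ meets k ν (a ∷ w))) ≡ rgsCount k m (decAt ν a) L
rgsCount-old k {a} ν L a<m = count-cong k L (λ w → cong₂ (λ x y → 𝟙 (x ∧ y)) (isRGS-old k w a<m) (meets-∷ k ν a w))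

rgsCount-new : ∀ k m ν L →
               count k L (λ w → 𝟙 (isRGS m (m ∷ w) k ∧ meets k ν (m ∷ w))) ≡ rgsCount k (suc m) (decAt ν m) L
rgsCount-new k m ν L = count-cong k L (λ w → cong₂ (λ x y → 𝟙 (x ∧ y)) (isRGS-new m k w) (meets-∷ k ν m w))

rgsCount-skip : ∀ k {a m} ν L → m < a →
                count k L (λ w → 𝟙 (isRGS m (a ∷ w) k ∧ meets k ν (a ∷ w))) ≡ 0
rgsCount-skip k {a} ν L m<a =
  trans (count-cong k L (λ w → cong (λ x → 𝟙 (x ∧ meets k ν (a ∷ w))) (isRGS-skip k w m<a))) (count-zero k L)

any-applyUpTo-true : ∀ (p : ℕ → Bool) h {a} n → a < n → p (h a) ≡ true → any p (applyUpTo h n) ≡ true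
any-applyUpTo-true p h {zero}  (suc n) _         pha rewrite pha = refl
any-applyUpTo-true p h {suc a} (suc n) (s≤s a<n) pha =
  trans (cong (p (h 0) ∨_) (any-applyUpTo-true p (λ i → h (suc i)) n a<n pha)) (∨-zeroʳ (p (h 0)))

any-applyUpTo-false : ∀ (p : ℕ → Bool) h n → (∀ i → p (h i) ≡ false) → any p (applyUpTo h n) ≡ false
any-applyUpTo-false p h zero    _   = refl
any-applyUpTo-false p h (suc n) p∘h rewrite p∘h 0 = any-applyUpTo-false p (λ i → h (suc i)) n (λ i → p∘h (suc i))

allDistinct-applyUpTo : ∀ h n → (∀ i j → h i ≡ h j → i ≡ j) → allDistinct (applyUpTo h n) ≡ true
allDistinct-applyUpTo h zero    _     = refl
allDistinct-applyUpTo h (suc n) h-inj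
  rewrite any-applyUpTo-false (h 0 ≡ᵇ_) (λ i → h (suc i)) n (λ i → ≡ᵇ-false (λ eq → 0≢1+n (h-inj 0 (suc i) eq)))
  = allDistinct-applyUpTo (λ i → h (suc i)) n (λ i j eq → suc-injective (h-inj (suc i) (suc j) eq))

any-++-∷ : ∀ a xs t → any (a ≡ᵇ_) (xs ++ a ∷ t) ≡ true
any-++-∷ a []       t rewrite ≡ᵇ-refl a = refl
any-++-∷ a (x ∷ xs) t = trans (cong ((a ≡ᵇ x) ∨_) (any-++-∷ a xs t)) (∨-zeroʳ (a ≡ᵇ x))

allDistinct-++-∷ : ∀ {a} xs t → any (a ≡ᵇ_) xs ≡ true → allDistinct (xs ++ a ∷ t) ≡ false
allDistinct-++-∷ {a} (x ∷ xs) t a∈x∷xs with a ≟ x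
... | yes refl = cong (λ b → not b ∧ allDistinct (xs ++ a ∷ t)) (any-++-∷ a xs t)
... | no a≢x   = trans (cong (not (any (x ≡ᵇ_) (xs ++ a ∷ t)) ∧_) (allDistinct-++-∷ xs t a∈xs)) (∧-zeroʳ _)
  where
  a∈xs : any (a ≡ᵇ_) xs ≡ true
  a∈xs = subst (λ b → b ∨ any (a ≡ᵇ_) xs ≡ true) (≡ᵇ-false a≢x) a∈x∷xs

upTo-++-∷ : ∀ m t → upTo m ++ m ∷ t ≡ upTo (suc m) ++ t
upTo-++-∷ m t = trans (sym (++-assoc (upTo m) [ m ] t)) (cong (_++ t) (applyUpTo-∷ʳ (λ c → c) m))

-- Labels below m already hold a forced prefix element, so they need one element fewer.
need : ℕ → ℕ → ℕ → ℕ
need s m x = if x <ᵇ m then s ∸ 1 else s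

decAt-need : ∀ s m x → decAt (need s m) m x ≡ need s (suc m) x
decAt-need s m x with x ≟ m
... | yes refl rewrite ≡ᵇ-refl x | <ᵇ-false {x} {x} ≤-refl | <ᵇ-true (n<1+n x) = pred[m∸n]≡m∸[1+n] s 0
... | no x≢m   rewrite <ᵇ-suc x m | ≡ᵇ-false x≢m | ∨-identityʳ (x <ᵇ m) = refl

distinctPrefix : ℕ → ℕ → ℕ → ℕ → List ℕ → Bool
distinctPrefix s k m r w = isRGS m w k ∧ allDistinct (upTo m ++ take r w) ∧ meets k (need s m) w

distinctPrefix-forced : ∀ s k m r w → distinctPrefix s k m (suc r) (m ∷ w) ≡ distinctPrefix s k (suc m) r w
distinctPrefix-forced s k m r w rewrite isRGS-new m k w | upTo-++-∷ m (take r w) | meets-∷ k (need s m) m w =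
  cong (λ b → isRGS (suc m) w k ∧ allDistinct (upTo (suc m) ++ take r w) ∧ b) (meets-cong k (decAt-need s m) w)

distinctPrefix-other : ∀ s k {m a} r w → a ≢ m → distinctPrefix s k m (suc r) (a ∷ w) ≡ false
distinctPrefix-other s k {m} {a} r w a≢m with <-cmp a m
... | tri< a<m _ _ =
  trans (cong (λ b → isRGS m (a ∷ w) k ∧ b ∧ meets k (need s m) (a ∷ w))
              (allDistinct-++-∷ (upTo m) (take r w) (any-applyUpTo-true (a ≡ᵇ_) (λ c → c) m a<m (≡ᵇ-refl a))))
        (∧-zeroʳ (isRGS m (a ∷ w) k))
... | tri≈ _ a≡m _ = ⊥-elim (a≢m a≡m)
... | tri> _ _ m<a =
  cong (λ b → b ∧ allDistinct (upTo m ++ a ∷ take r w) ∧ meets k (need s m) (a ∷ w)) (isRGS-skip k w m<a)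

-- Once 0, …, m - 1 are used, a smaller letter repeats one of them and a larger one breaks
-- the growth condition, so the letters of a distinct prefix are forced to be m, m + 1, ….
distinct-prefix : ∀ s k m r L → m + r ≤ k →
  count k (r + L) (λ w → 𝟙 (distinctPrefix s k m r w)) ≡ rgsCount k (m + r) (need s (m + r)) L
distinct-prefix s k m zero L _ rewrite +-identityʳ m =
  count-cong k L (λ w → cong (λ b → 𝟙 (isRGS m w k ∧ b ∧ meets k (need s m) w)) upTo-distinct)
  where
  upTo-distinct : allDistinct (upTo m ++ []) ≡ true
  upTo-distinct = trans (cong allDistinct (++-identityʳ (upTo m))) (allDistinct-applyUpTo (λ c → c) m (λ _ _ eq → eq))
distinct-prefix s k m (suc r) L m+r<k = begin
  count k (suc (r + L)) P
    ≡⟨ count-∷ k (r + L) P ⟩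
  ∑[ c < k ] count k (r + L) (λ w → P (toℕ c ∷ w))
    ≡⟨ ∑-single (λ c → count k (r + L) (λ w → P (toℕ c ∷ w))) m′ other ⟩
  count k (r + L) (λ w → P (toℕ m′ ∷ w))
    ≡⟨ cong (λ a → count k (r + L) (λ w → P (a ∷ w))) (toℕ-fromℕ< m<k) ⟩
  count k (r + L) (λ w → P (m ∷ w))
    ≡⟨ count-cong k (r + L) (λ w → cong 𝟙 (distinctPrefix-forced s k m r w)) ⟩
  count k (r + L) (λ w → 𝟙 (distinctPrefix s k (suc m) r w))
    ≡⟨ distinct-prefix s k (suc m) r L (subst (_≤ k) (+-suc m r) m+r<k) ⟩
  rgsCount k (suc m + r) (need s (suc m + r)) L
    ≡⟨ cong (λ m+r → rgsCount k m+r (need s m+r) L) (+-suc m r) ⟨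
  rgsCount k (m + suc r) (need s (m + suc r)) L ∎
  where
  P : List ℕ → ℕ
  P w = 𝟙 (distinctPrefix s k m (suc r) w)
  m<k : m < k
  m<k = <-≤-trans (m<m+n m (s≤s z≤n)) m+r<k
  m′ : Fin k
  m′ = fromℕ< m<k
  other : ∀ c → c ≢ m′ → count k (r + L) (λ w → P (toℕ c ∷ w)) ≡ 0
  other c c≢m′ = trans (count-cong k (r + L) (λ w → cong 𝟙 (distinctPrefix-other s k r w c≢m)))
                       (count-zero k (r + L))
    where
    c≢m : toℕ c ≢ m
    c≢m eq = c≢m′ (toℕ-injective (trans eq (sym (toℕ-fromℕ< m<k))))

-- Words with prescribed minimal multiplicities

-- The number of words of length L over Fin k in which each letter c occurs at least ν c times.
atLeast : ∀ {k} → Vector ℕ k → ℕ → ℕ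
atLeast ν zero        = 𝟙 (∑ ν ≡ᵇ 0)
atLeast {k} ν (suc L) = ∑[ c < k ] atLeast (updateAt ν c pred) L

updateAt-≗ : ∀ {k} (c : Fin k) {f : ℕ → ℕ} {ν μ : Vector ℕ k} → (∀ i → ν i ≡ μ i) →
             ∀ i → updateAt ν c f i ≡ updateAt μ c f i
updateAt-≗ zero    {f} ν≗μ zero    = cong f (ν≗μ zero)
updateAt-≗ zero        ν≗μ (suc i) = ν≗μ (suc i)
updateAt-≗ (suc c)     ν≗μ zero    = ν≗μ zero
updateAt-≗ (suc c)     ν≗μ (suc i) = updateAt-≗ c (λ j → ν≗μ (suc j)) i

atLeast-cong : ∀ {k} {ν μ : Vector ℕ k} → (∀ i → ν i ≡ μ i) → ∀ L → atLeast ν L ≡ atLeast μ L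
atLeast-cong {k} ν≗μ zero    = cong (λ x → 𝟙 (x ≡ᵇ 0)) (∑-cong {k} ν≗μ)
atLeast-cong {k} ν≗μ (suc L) = ∑-cong {k} (λ c → atLeast-cong (updateAt-≗ c ν≗μ) L)

updateAt-permute : ∀ {m n} (π : Permutation m n) (ν : Vector ℕ n) c {f : ℕ → ℕ} i →
                   updateAt (ν ∘ (π ⟨$⟩ʳ_)) c f i ≡ updateAt ν (π ⟨$⟩ʳ c) f (π ⟨$⟩ʳ i)
updateAt-permute π ν c i with i ≟ᶠ c
... | yes refl = trans (updateAt-updates i (ν ∘ (π ⟨$⟩ʳ_))) (sym (updateAt-updates (π ⟨$⟩ʳ i) ν))
... | no i≢c   = trans (updateAt-minimal i c (ν ∘ (π ⟨$⟩ʳ_)) i≢c) (sym (updateAt-minimal _ _ ν (i≢c ∘ π-injective)))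
  where
  π-injective : π ⟨$⟩ʳ i ≡ π ⟨$⟩ʳ c → i ≡ c
  π-injective eq = trans (sym (inverseˡ π)) (trans (cong (π ⟨$⟩ˡ_) eq) (inverseˡ π))

atLeast-permute : ∀ {m n} (π : Permutation m n) (ν : Vector ℕ n) L → atLeast (ν ∘ (π ⟨$⟩ʳ_)) L ≡ atLeast ν L
atLeast-permute π ν zero    = cong (λ x → 𝟙 (x ≡ᵇ 0)) (sym (∑-permute ν π))
atLeast-permute {m} {n} π ν (suc L) = begin
  ∑[ c < m ] atLeast (updateAt (ν ∘ (π ⟨$⟩ʳ_)) c pred) L
    ≡⟨ ∑-cong {m} (λ c → atLeast-cong (updateAt-permute π ν c) L) ⟩
  ∑[ c < m ] atLeast (updateAt ν (π ⟨$⟩ʳ c) pred ∘ (π ⟨$⟩ʳ_)) L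
    ≡⟨ ∑-cong {m} (λ c → atLeast-permute π (updateAt ν (π ⟨$⟩ʳ c) pred) L) ⟩
  ∑[ c < m ] atLeast (updateAt ν (π ⟨$⟩ʳ c) pred) L
    ≡⟨ ∑-permute (λ c → atLeast (updateAt ν c pred) L) π ⟨
  ∑[ c < n ] atLeast (updateAt ν c pred) L ∎

atLeast-exchange : ∀ {k} (ν : Vector ℕ k) a b → ν a ≡ ν b → ∀ L →
                   atLeast (updateAt ν a pred) L ≡ atLeast (updateAt ν b pred) L
atLeast-exchange ν a b νa≡νb L =
  trans (atLeast-cong swapped L) (atLeast-permute (transpose a b) (updateAt ν b pred) L)
  where
  swapped : ∀ i → updateAt ν a pred i ≡ updateAt ν b pred (transpose a b ⟨$⟩ʳ i)
  swapped i with i ≟ᶠ a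
  ... | yes refl = trans (updateAt-updates i ν) (trans (cong pred νa≡νb) (sym (updateAt-updates b ν)))
  ... | no i≢a with i ≟ᶠ b
  ...   | yes refl = trans (updateAt-minimal i a ν i≢a) (trans (sym νa≡νb) (sym (updateAt-minimal a i ν (i≢a ∘ sym))))
  ...   | no i≢b   = trans (updateAt-minimal i a ν i≢a) (sym (updateAt-minimal i b ν i≢b))

atLeast-∷ : ∀ {k} t (ν : Vector ℕ k) L →
            atLeast (t Vec.∷ ν) (suc L) ≡ atLeast (pred t Vec.∷ ν) L + ∑[ c < k ] atLeast (t Vec.∷ updateAt ν c pred) L
atLeast-∷ {k} t ν L = cong₂ _+_ (atLeast-cong first L) (∑-cong {k} (λ c → atLeast-cong (later c) L))
  where
  first : ∀ i → updateAt (t Vec.∷ ν) zero pred i ≡ (pred t Vec.∷ ν) i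
  first zero    = refl
  first (suc i) = refl
  later : ∀ c i → updateAt (t Vec.∷ ν) (suc c) pred i ≡ (t Vec.∷ updateAt ν c pred) i
  later c zero    = refl
  later c (suc i) = refl

C*atLeast-suc : ∀ {k} (ν : Vector ℕ k) L t →
            (L C t) * ∑[ c < k ] atLeast (updateAt ν c pred) (L ∸ t) ≡ (L C t) * atLeast ν (suc L ∸ t)
C*atLeast-suc ν L t with t ≤? L
... | yes t≤L = cong (λ x → (L C t) * atLeast ν x) (sym (+-∸-assoc 1 t≤L))
... | no  t≰L rewrite k>n⇒nCk≡0 (≰⇒> t≰L) = refl

-- Letter 0 occurs at least t times iff it occurs at least t + 1 times or exactly t times;
-- in the latter case its positions are one of L C t choices and the rest avoids letter 0.
atLeast-peel : ∀ {k} L t (ν : Vector ℕ k) →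
               atLeast (t Vec.∷ ν) L ≡ atLeast (suc t Vec.∷ ν) L + (L C t) * atLeast ν (L ∸ t)
atLeast-peel zero    zero    ν = sym (+-identityʳ _)
atLeast-peel zero    (suc t) ν = refl
atLeast-peel {k} (suc L) t ν = begin
  atLeast (t Vec.∷ ν) (suc L)
    ≡⟨ atLeast-∷ t ν L ⟩
  atLeast (pred t Vec.∷ ν) L + ∑[ c < k ] atLeast (t Vec.∷ ν′ c) L
    ≡⟨ cong (atLeast (pred t Vec.∷ ν) L +_) rest ⟩
  atLeast (pred t Vec.∷ ν) L + (A + (L C t) * atLeast ν (suc L ∸ t))
    ≡⟨ x+[y+z]≡[x+z]+y (atLeast (pred t Vec.∷ ν) L) A _ ⟩
  atLeast (pred t Vec.∷ ν) L + (L C t) * atLeast ν (suc L ∸ t) + A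
    ≡⟨ cong (_+ A) (first-letter t) ⟩
  atLeast (t Vec.∷ ν) L + (suc L C t) * atLeast ν (suc L ∸ t) + A
    ≡⟨ [x+y]+z≡[x+z]+y (atLeast (t Vec.∷ ν) L) _ A ⟩
  atLeast (t Vec.∷ ν) L + A + (suc L C t) * atLeast ν (suc L ∸ t)
    ≡⟨ cong (_+ (suc L C t) * atLeast ν (suc L ∸ t)) (atLeast-∷ (suc t) ν L) ⟨
  atLeast (suc t Vec.∷ ν) (suc L) + (suc L C t) * atLeast ν (suc L ∸ t) ∎
  where
  ν′ : Fin k → Vector ℕ k
  ν′ c = updateAt ν c pred
  A : ℕ
  A = ∑[ c < k ] atLeast (suc t Vec.∷ ν′ c) L
  rest : ∑[ c < k ] atLeast (t Vec.∷ ν′ c) L ≡ A + (L C t) * atLeast ν (suc L ∸ t)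
  rest = begin
    ∑[ c < k ] atLeast (t Vec.∷ ν′ c) L
      ≡⟨ ∑-cong {k} (λ c → atLeast-peel L t (ν′ c)) ⟩
    ∑[ c < k ] (atLeast (suc t Vec.∷ ν′ c) L + (L C t) * atLeast (ν′ c) (L ∸ t))
      ≡⟨ ∑-distrib-+ {k} (λ c → atLeast (suc t Vec.∷ ν′ c) L) (λ c → (L C t) * atLeast (ν′ c) (L ∸ t)) ⟩
    A + ∑[ c < k ] ((L C t) * atLeast (ν′ c) (L ∸ t))
      ≡⟨ cong (A +_) (*-distribˡ-sum (L C t) (λ c → atLeast (ν′ c) (L ∸ t))) ⟨
    A + (L C t) * ∑[ c < k ] atLeast (ν′ c) (L ∸ t)
      ≡⟨ cong (A +_) (C*atLeast-suc ν L t) ⟩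
    A + (L C t) * atLeast ν (suc L ∸ t) ∎
  first-letter : ∀ t → atLeast (pred t Vec.∷ ν) L + (L C t) * atLeast ν (suc L ∸ t)
                       ≡ atLeast (t Vec.∷ ν) L + (suc L C t) * atLeast ν (suc L ∸ t)
  first-letter zero    = refl
  first-letter (suc t) = begin
    atLeast (t Vec.∷ ν) L + (L C suc t) * X
      ≡⟨ cong (_+ (L C suc t) * X) (atLeast-peel L t ν) ⟩
    atLeast (suc t Vec.∷ ν) L + (L C t) * X + (L C suc t) * X
      ≡⟨ +-assoc (atLeast (suc t Vec.∷ ν) L) _ _ ⟩
    atLeast (suc t Vec.∷ ν) L + ((L C t) * X + (L C suc t) * X)
      ≡⟨ cong (atLeast (suc t Vec.∷ ν) L +_) (*-distribʳ-+ X (L C t) (L C suc t)) ⟨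
    atLeast (suc t Vec.∷ ν) L + (L C t + L C suc t) * X
      ≡⟨ cong (λ c → atLeast (suc t Vec.∷ ν) L + c * X) (nCk+nC[k+1]≡[n+1]C[k+1] L t) ⟩
    atLeast (suc t Vec.∷ ν) L + (suc L C suc t) * X ∎
    where
    X = atLeast ν (L ∸ t)

updateAt-toℕ : ∀ {k} (ν : ℕ → ℕ) (c : Fin k) i → updateAt (ν ∘ toℕ) c pred i ≡ decAt ν (toℕ c) (toℕ i)
updateAt-toℕ ν c i with i ≟ᶠ c
... | yes refl rewrite ≡ᵇ-refl (toℕ i)                    = updateAt-updates i (ν ∘ toℕ)
... | no i≢c   rewrite ≡ᵇ-false (i≢c ∘ toℕ-injective) = updateAt-minimal i c (ν ∘ toℕ) i≢c

decAt-below : ∀ ν {a m} → a < m → ∀ x → m ≤ x → decAt ν a x ≡ ν x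
decAt-below ν a<m x m≤x rewrite ≡ᵇ-false (>⇒≢ (<-≤-trans a<m m≤x)) = refl

-- Takes the induction hypothesis of rgsCount-unlabel as an argument, so that j can be split on.
new-letters : ∀ s L m j ν → (∀ x → m ≤ x → ν x ≡ suc s) →
  (∀ j′ → suc m + j′ ≡ m + j →
          rgsCount (m + j) (suc m) (decAt ν m) L * j′ ! ≡ atLeast {m + j} (decAt ν m ∘ toℕ) L) →
  ∑[ x < j ] (count (m + j) L (λ w → 𝟙 (isRGS m (toℕ (m ↑ʳ x) ∷ w) (m + j) ∧ meets (m + j) ν (toℕ (m ↑ʳ x) ∷ w)))
              * j !)
    ≡ ∑[ x < j ] atLeast (updateAt (ν ∘ toℕ) (m ↑ʳ x) pred) L
new-letters s L m zero    ν fresh unlabel = refl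
new-letters s L m (suc j) ν fresh unlabel = begin
  ∑[ x < suc j ] (G x * suc j !)
    ≡⟨ *-distribʳ-sum (suc j !) G ⟨
  ∑[ x < suc j ] G x * suc j !
    ≡⟨ cong (_* suc j !) (∑-single G zero later-zero) ⟩
  G zero * (suc j * j !)
    ≡⟨ x*[y*z]≡y*[x*z] (G zero) (suc j) (j !) ⟩
  suc j * (G zero * j !)
    ≡⟨ cong (λ y → suc j * (y * j !)) (trans (cong (λ a → count k L (λ w → F (a ∷ w))) toℕ-m′)
                                              (rgsCount-new k m ν L)) ⟩
  suc j * (rgsCount k (suc m) (decAt ν m) L * j !)
    ≡⟨ cong (suc j *_) (unlabel j (sym (+-suc m j))) ⟩
  suc j * atLeast (decAt ν m ∘ toℕ) L
    ≡⟨ cong (suc j *_) (atLeast-cong (λ i → trans (updateAt-toℕ ν m′ i) (cong (λ a → decAt ν a (toℕ i)) toℕ-m′))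
                                     L) ⟨
  suc j * atLeast (updateAt (ν ∘ toℕ) m′ pred) L
    ≡⟨ ∑-const (suc j) _ ⟨
  ∑[ x < suc j ] atLeast (updateAt (ν ∘ toℕ) m′ pred) L
    ≡⟨ ∑-cong {suc j} (λ x → atLeast-exchange (ν ∘ toℕ) m′ (m ↑ʳ x) (same-need x) L) ⟩
  ∑[ x < suc j ] atLeast (updateAt (ν ∘ toℕ) (m ↑ʳ x) pred) L ∎
  where
  k = m + suc j
  F : List ℕ → ℕ
  F w = 𝟙 (isRGS m w k ∧ meets k ν w)
  G : Fin (suc j) → ℕ
  G x = count k L (λ w → F (toℕ (m ↑ʳ x) ∷ w))
  m′ : Fin k
  m′ = m ↑ʳ zero
  toℕ-m′ : toℕ m′ ≡ m
  toℕ-m′ = trans (toℕ-↑ʳ m (zero {j})) (+-identityʳ m)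
  m≤toℕ : ∀ x → m ≤ toℕ (m ↑ʳ x)
  m≤toℕ x = subst (m ≤_) (sym (toℕ-↑ʳ m x)) (m≤m+n m (toℕ x))
  later-zero : ∀ x → x ≢ zero → G x ≡ 0
  later-zero zero    0≢0 = ⊥-elim (0≢0 refl)
  later-zero (suc x) _   = rgsCount-skip k ν L (subst (m <_) (sym (toℕ-↑ʳ m (suc x))) (m<m+n m (s≤s z≤n)))
  same-need : ∀ x → ν (toℕ m′) ≡ ν (toℕ (m ↑ʳ x))
  same-need x = trans (fresh (toℕ m′) (m≤toℕ zero)) (sym (fresh (toℕ (m ↑ʳ x)) (m≤toℕ x)))

-- A restricted growth string names the j fresh blocks in order of first appearance, a word
-- names them arbitrarily; all j ! namings are equally frequent since fresh labels have equal
-- needs (atLeast-exchange).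
rgsCount-unlabel : ∀ s L {k} m j ν → m + j ≡ k → (∀ x → m ≤ x → ν x ≡ suc s) →
                   rgsCount k m ν L * j ! ≡ atLeast {k} (ν ∘ toℕ) L
rgsCount-unlabel s zero m zero ν refl _
  rewrite dec-true (m ≟ m + 0) (sym (+-identityʳ m)) | meets-[] (m + 0) ν =
  trans (*-identityʳ _) (+-identityʳ _)
rgsCount-unlabel s zero m (suc j) ν refl fresh
  rewrite ≡ᵇ-false (<⇒≢ (m<m+n m {suc j} (s≤s z≤n))) =
  cong 𝟙 (sym (∑≡ᵇ0-false (ν ∘ toℕ) (m ↑ʳ zero) fresh-m))
  where
  fresh-m : ν (toℕ (m ↑ʳ zero)) ≡ suc s
  fresh-m = trans (cong ν (trans (toℕ-↑ʳ m zero) (+-identityʳ m))) (fresh m ≤-refl)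
rgsCount-unlabel s (suc L) m j ν refl fresh = begin
  rgsCount k m ν (suc L) * j !
    ≡⟨ cong (_* j !) (trans (count-∷ k L F) (∑-split m (λ c → count k L (λ w → F (toℕ c ∷ w))))) ⟩
  (∑[ i < m ] old i + ∑[ x < j ] new x) * j !
    ≡⟨ *-distribʳ-+ (j !) (∑[ i < m ] old i) (∑[ x < j ] new x) ⟩
  ∑[ i < m ] old i * j ! + ∑[ x < j ] new x * j !
    ≡⟨ cong₂ _+_ (trans (*-distribʳ-sum (j !) old) (∑-cong {m} old-letter))
                 (trans (*-distribʳ-sum (j !) new)
                        (new-letters s L m j ν fresh
                                     (λ j′ eq → rgsCount-unlabel s L (suc m) j′ (decAt ν m) eq fresh-after-m))) ⟩
  ∑[ i < m ] atLeast (updateAt (ν ∘ toℕ) (i ↑ˡ j) pred) L + ∑[ x < j ] atLeast (updateAt (ν ∘ toℕ) (m ↑ʳ x) pred) L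
    ≡⟨ ∑-split m (λ c → atLeast (updateAt (ν ∘ toℕ) c pred) L) ⟨
  atLeast {k} (ν ∘ toℕ) (suc L) ∎
  where
  k = m + j
  F : List ℕ → ℕ
  F w = 𝟙 (isRGS m w k ∧ meets k ν w)
  old : Fin m → ℕ
  old i = count k L (λ w → F (toℕ (i ↑ˡ j) ∷ w))
  new : Fin j → ℕ
  new x = count k L (λ w → F (toℕ (m ↑ʳ x) ∷ w))
  fresh-after-m : ∀ x → suc m ≤ x → decAt ν m x ≡ suc s
  fresh-after-m x m<x = trans (decAt-below ν (n<1+n m) x m<x) (fresh x (<⇒≤ m<x))
  old-letter : ∀ i → old i * j ! ≡ atLeast (updateAt (ν ∘ toℕ) (i ↑ˡ j) pred) L
  old-letter i = begin
    count k L (λ w → F (a ∷ w)) * j !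
      ≡⟨ cong (_* j !) (rgsCount-old k ν L a<m) ⟩
    rgsCount k m (decAt ν a) L * j !
      ≡⟨ rgsCount-unlabel s L m j (decAt ν a) refl (λ x m≤x → trans (decAt-below ν a<m x m≤x) (fresh x m≤x)) ⟩
    atLeast (decAt ν a ∘ toℕ) L
      ≡⟨ atLeast-cong (updateAt-toℕ ν (i ↑ˡ j)) L ⟨
    atLeast (updateAt (ν ∘ toℕ) (i ↑ˡ j) pred) L ∎
    where
    a = toℕ (i ↑ˡ j)
    a<m : a < m
    a<m = subst (_< m) (sym (toℕ-↑ˡ i j)) (toℕ<n i)

need-suc : ∀ s {a} x → suc x ≢ a → need s a (suc x) ≡ need s a x
need-suc s {a} x 1+x≢a with <-cmp x a
... | tri< x<a _ _ rewrite <ᵇ-true (≤∧≢⇒< x<a 1+x≢a) | <ᵇ-true x<a = refl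
... | tri≈ _ refl _ rewrite <ᵇ-false (n≤1+n x) | <ᵇ-false {x} {x} ≤-refl = refl
... | tri> _ _ a<x rewrite <ᵇ-false (m<n⇒m≤1+n a<x) | <ᵇ-false (<⇒≤ a<x) = refl

need-rotate : ∀ s a {n} (j : Fin (suc n)) → toℕ j ≡ a →
              ∀ i → need s a (toℕ (transpose zero j ⟨$⟩ʳ i)) ≡ (s Vec.∷ (need s a ∘ toℕ)) i
need-rotate s a j refl zero rewrite <ᵇ-false {toℕ j} {toℕ j} ≤-refl = refl
need-rotate s a j refl (suc i) with suc i ≟ᶠ j
... | yes refl rewrite <ᵇ-true (n<1+n (toℕ i)) = refl
... | no 1+i≢j = need-suc s (toℕ i) (1+i≢j ∘ toℕ-injective)

atLeast-rotate : ∀ s a b L →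
                 atLeast {suc (a + b)} (s Vec.∷ (need s a ∘ toℕ)) L ≡ atLeast {a + suc b} (need s a ∘ toℕ) L
atLeast-rotate s a b L = trans (sym (atLeast-cong rotate L)) (atLeast-permute π (need s a ∘ toℕ) L)
  where
  a′ : Fin (suc (a + b))
  a′ = fromℕ< (s≤s (m≤m+n a b))
  π : Permutation (suc (a + b)) (a + suc b)
  π = transpose zero a′ ∘ₚ cast-id (sym (+-suc a b))
  rotate : ∀ i → need s a (toℕ (π ⟨$⟩ʳ i)) ≡ (s Vec.∷ (need s a ∘ toℕ)) i
  rotate i = trans (cong (need s a) (toℕ-cast _ (transpose zero a′ ⟨$⟩ʳ i))) (need-rotate s a a′ (toℕ-fromℕ< _) i)

-- a labels that already hold one element and b fresh labels.
labelled : ℕ → ℕ → ℕ → ℕ → ℕ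
labelled s a b L = atLeast {a + b} (need s a ∘ toℕ) L

S-unlabel : ∀ s r b L → S (suc s) r (r + L) (r + b) * b ! ≡ labelled (suc s) r b L
S-unlabel s r b L = begin
  S (suc s) r (r + L) k * b !                 ≡⟨ cong (_* b !) (S≡count (suc s) r (r + L) k) ⟩
  count k (r + L) (λ w → 𝟙 (good (suc s) r k w)) * b !
                                              ≡⟨ cong (_* b !) (distinct-prefix (suc s) k 0 r L (m≤m+n r b)) ⟩
  rgsCount k r (need (suc s) r) L * b !       ≡⟨ rgsCount-unlabel s L r b (need (suc s) r) refl fresh ⟩
  labelled (suc s) r b L                      ∎
  where
  k = r + b
  fresh : ∀ x → r ≤ x → need (suc s) r x ≡ suc s
  fresh x r≤x rewrite <ᵇ-false r≤x = refl

labelled-rec : ∀ s a b L →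
               labelled (suc s) (suc a) b L ≡ labelled (suc s) a (suc b) L + (L C s) * labelled (suc s) a b (L ∸ s)
labelled-rec s a b L = begin
  atLeast (need (suc s) (suc a) ∘ toℕ) L
    ≡⟨ atLeast-cong (λ { zero → refl ; (suc i) → refl }) L ⟩
  atLeast (s Vec.∷ (need (suc s) a ∘ toℕ)) L
    ≡⟨ atLeast-peel L s (need (suc s) a ∘ toℕ) ⟩
  atLeast (suc s Vec.∷ (need (suc s) a ∘ toℕ)) L + (L C s) * labelled (suc s) a b (L ∸ s)
    ≡⟨ cong (_+ (L C s) * labelled (suc s) a b (L ∸ s)) (atLeast-rotate (suc s) a b L) ⟩
  labelled (suc s) a (suc b) L + (L C s) * labelled (suc s) a b (L ∸ s) ∎

-- The number of ways to choose i disjoint ordered blocks of size d among L elements.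
chooseBlocks : ℕ → ℕ → ℕ → ℕ
chooseBlocks d zero    L = 1
chooseBlocks d (suc i) L = chooseBlocks d i L * ((L ∸ i * d) C d)

labelled-expand : ∀ s p a b L →
  labelled (suc s) (a + p) b L
    ≡ ∑[ i ≤ p ] ((p C toℕ i) * (chooseBlocks s (toℕ i) L * labelled (suc s) a (b + p ∸ toℕ i) (L ∸ toℕ i * s)))
labelled-expand s zero a b L rewrite +-identityʳ a | +-identityʳ b =
  sym (trans (+-identityʳ _) (trans (+-identityʳ _) (+-identityʳ _)))
labelled-expand s (suc p) a b L = begin
  labelled (suc s) (a + suc p) b L
    ≡⟨ cong (λ a′ → labelled (suc s) a′ b L) (+-suc a p) ⟩
  labelled (suc s) (suc a + p) b L
    ≡⟨ labelled-expand s p (suc a) b L ⟩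
  ∑[ i ≤ p ] ((p C toℕ i) * (chooseBlocks s (toℕ i) L * labelled (suc s) (suc a) (b + p ∸ toℕ i) (L ∸ toℕ i * s)))
    ≡⟨ ∑-cong {suc p} (λ i → cong ((p C toℕ i) *_) (split (toℕ i) (≤-pred (toℕ<n i)))) ⟩
  ∑[ i ≤ p ] ((p C toℕ i) * (g (toℕ i) + g (suc (toℕ i))))
    ≡⟨ ∑-pascal p g ⟨
  ∑[ i ≤ suc p ] ((suc p C toℕ i) * g (toℕ i)) ∎
  where
  g : ℕ → ℕ
  g i = chooseBlocks s i L * labelled (suc s) a (b + suc p ∸ i) (L ∸ i * s)
  split : ∀ i → i ≤ p → chooseBlocks s i L * labelled (suc s) (suc a) (b + p ∸ i) (L ∸ i * s) ≡ g i + g (suc i)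
  split i i≤p = begin
    M * labelled (suc s) (suc a) (b + p ∸ i) Lᵢ
      ≡⟨ cong (M *_) (labelled-rec s a (b + p ∸ i) Lᵢ) ⟩
    M * (labelled (suc s) a (suc (b + p ∸ i)) Lᵢ + (Lᵢ C s) * labelled (suc s) a (b + p ∸ i) (Lᵢ ∸ s))
      ≡⟨ *-distribˡ-+ M _ _ ⟩
    M * labelled (suc s) a (suc (b + p ∸ i)) Lᵢ + M * ((Lᵢ C s) * labelled (suc s) a (b + p ∸ i) (Lᵢ ∸ s))
      ≡⟨ cong₂ _+_ (cong (λ b′ → M * labelled (suc s) a b′ Lᵢ) one-more-fresh)
                   (trans (sym (*-assoc M _ _))
                          (cong₂ (λ b′ L′ → M * (Lᵢ C s) * labelled (suc s) a (b′ ∸ suc i) L′)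
                                 (sym (+-suc b p)) one-block-more)) ⟩
    g i + g (suc i) ∎
    where
    M = chooseBlocks s i L
    Lᵢ = L ∸ i * s
    one-more-fresh : suc (b + p ∸ i) ≡ b + suc p ∸ i
    one-more-fresh = trans (sym (+-∸-assoc 1 (≤-trans i≤p (m≤n+m p b)))) (cong (_∸ i) (sym (+-suc b p)))
    one-block-more : Lᵢ ∸ s ≡ L ∸ suc i * s
    one-block-more = trans (∸-+-assoc L (i * s) s) (cong (L ∸_) (+-comm (i * s) s))

-- Coefficients

C*k!*[n∸k]!≡n! : ∀ {n k} → k ≤ n → (n C k) * (k ! * (n ∸ k) !) ≡ n !
C*k!*[n∸k]!≡n! {n} {k} k≤n = trans (cong (_* (k ! * (n ∸ k) !)) (nCk≡n!/k![n-k]! k≤n))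
                                   (m/n*n≡m {{k !* (n ∸ k) !≢0}} (k![n∸k]!∣n! k≤n))

chooseBlocks-factorials : ∀ d i L → i * d ≤ L → chooseBlocks d i L * ((d !) ^ i * (L ∸ i * d) !) ≡ L !
chooseBlocks-factorials d zero    L _ = trans (+-identityʳ _) (+-identityʳ _)
chooseBlocks-factorials d (suc i) L 1+i*d≤L = begin
  M * (Lᵢ C d) * (d ! * (d !) ^ i * (L ∸ (d + i * d)) !)
    ≡⟨ cong (λ x → M * (Lᵢ C d) * (d ! * (d !) ^ i * x !)) L∸[1+i]d ⟩
  M * (Lᵢ C d) * (d ! * (d !) ^ i * (Lᵢ ∸ d) !)
    ≡⟨ regroup M (Lᵢ C d) (d !) ((d !) ^ i) ((Lᵢ ∸ d) !) ⟩
  M * ((d !) ^ i * ((Lᵢ C d) * (d ! * (Lᵢ ∸ d) !)))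
    ≡⟨ cong (λ x → M * ((d !) ^ i * x)) (C*k!*[n∸k]!≡n! (m+n≤o⇒m≤o∸n d 1+i*d≤L)) ⟩
  M * ((d !) ^ i * Lᵢ !)
    ≡⟨ chooseBlocks-factorials d i L (≤-trans (m≤n+m (i * d) d) 1+i*d≤L) ⟩
  L ! ∎
  where
  M = chooseBlocks d i L
  Lᵢ = L ∸ i * d
  L∸[1+i]d : L ∸ (d + i * d) ≡ Lᵢ ∸ d
  L∸[1+i]d = trans (cong (L ∸_) (+-comm d (i * d))) (sym (∸-+-assoc L (i * d) d))
  regroup : ∀ m c x y z → m * c * (x * y * z) ≡ m * (y * (c * (x * z)))
  regroup = solve-∀

chooseBlocks-all : ∀ d i → chooseBlocks d i (i * d) * (d !) ^ i ≡ (i * d) !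
chooseBlocks-all d i = begin
  M * (d !) ^ i
    ≡⟨ cong (M *_) (*-identityʳ ((d !) ^ i)) ⟨
  M * ((d !) ^ i * 1)
    ≡⟨ cong (λ x → M * ((d !) ^ i * x !)) (n∸n≡0 (i * d)) ⟨
  M * ((d !) ^ i * (i * d ∸ i * d) !)
    ≡⟨ chooseBlocks-factorials d i (i * d) ≤-refl ⟩
  (i * d) ! ∎
  where
  M = chooseBlocks d i (i * d)

multinomial≡chooseBlocks : ∀ d i → (((i * d) !) / ((d !) ^ i)) {{m^n≢0 (d !) i {{d !≢0}}}} ≡ chooseBlocks d i (i * d)
multinomial≡chooseBlocks d i = begin
  (((i * d) !) / ((d !) ^ i)) {{d!^i≢0}}
    ≡⟨ cong (λ x → (x / ((d !) ^ i)) {{d!^i≢0}}) (chooseBlocks-all d i) ⟨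
  ((chooseBlocks d i (i * d) * (d !) ^ i) / ((d !) ^ i)) {{d!^i≢0}}
    ≡⟨ m*n/n≡m (chooseBlocks d i (i * d)) ((d !) ^ i) {{d!^i≢0}} ⟩
  chooseBlocks d i (i * d) ∎
  where
  d!^i≢0 = m^n≢0 (d !) i {{d !≢0}}

chooseBlocks-split : ∀ d i L → i * d ≤ L → (L C (i * d)) * chooseBlocks d i (i * d) ≡ chooseBlocks d i L
chooseBlocks-split d i L i*d≤L = *-cancelʳ-≡ _ _ ((d !) ^ i * (L ∸ i * d) !) {{factorials≢0}} (begin
  (L C (i * d)) * chooseBlocks d i (i * d) * ((d !) ^ i * (L ∸ i * d) !)
    ≡⟨ regroup (L C (i * d)) (chooseBlocks d i (i * d)) ((d !) ^ i) ((L ∸ i * d) !) ⟩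
  (L C (i * d)) * ((chooseBlocks d i (i * d) * (d !) ^ i) * (L ∸ i * d) !)
    ≡⟨ cong (λ x → (L C (i * d)) * (x * (L ∸ i * d) !)) (chooseBlocks-all d i) ⟩
  (L C (i * d)) * ((i * d) ! * (L ∸ i * d) !)
    ≡⟨ C*k!*[n∸k]!≡n! i*d≤L ⟩
  L !
    ≡⟨ chooseBlocks-factorials d i L i*d≤L ⟨
  chooseBlocks d i L * ((d !) ^ i * (L ∸ i * d) !) ∎)
  where
  factorials≢0 = m*n≢0 ((d !) ^ i) ((L ∸ i * d) !) {{m^n≢0 (d !) i {{d !≢0}}}} {{(L ∸ i * d) !≢0}}
  regroup : ∀ c m x y → c * m * (x * y) ≡ c * ((m * x) * y)
  regroup = solve-∀

m≡n+o⇒m∸o≡n : ∀ {m n o} → m ≡ n + o → m ∸ o ≡ n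
m≡n+o⇒m∸o≡n {n = n} {o} m≡n+o = trans (cong (_∸ o) m≡n+o) (m+n∸n≡m n o)

labels-left : ∀ {i p r k} → i ≤ p → p ≤ r → r ≤ k → k ∸ i ≡ r ∸ p + (k ∸ r + p ∸ i)
labels-left {i} {p} {r} {k} i≤p p≤r r≤k = m≡n+o⇒m∸o≡n (begin
  k                               ≡⟨ m∸n+n≡m r≤k ⟨
  k ∸ r + r                       ≡⟨ cong (k ∸ r +_) (m∸n+n≡m p≤r) ⟨
  k ∸ r + (r ∸ p + p)             ≡⟨ x+[y+z]≡y+[x+z] (k ∸ r) (r ∸ p) p ⟩
  r ∸ p + (k ∸ r + p)             ≡⟨ cong (r ∸ p +_) (m∸n+n≡m (≤-trans i≤p (m≤n+m p (k ∸ r)))) ⟨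
  r ∸ p + (k ∸ r + p ∸ i + i)     ≡⟨ +-assoc (r ∸ p) _ i ⟨
  r ∸ p + (k ∸ r + p ∸ i) + i     ∎)

elements-left : ∀ {p r x n} → p ≤ r → r + x ≤ n → n ∸ p ∸ x ≡ r ∸ p + (n ∸ r ∸ x)
elements-left {p} {r} {x} {n} p≤r r+x≤n = trans (∸-+-assoc n p x) (m≡n+o⇒m∸o≡n (begin
  n                               ≡⟨ m+[n∸m]≡n r+x≤n ⟨
  r + x + (n ∸ (r + x))           ≡⟨ cong₂ (λ r′ y → r′ + x + y) (m∸n+n≡m p≤r) (∸-+-assoc n r x) ⟨
  r ∸ p + p + x + (n ∸ r ∸ x)     ≡⟨ regroup (r ∸ p) p x (n ∸ r ∸ x) ⟩
  r ∸ p + (n ∸ r ∸ x) + (p + x)   ∎))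
  where
  regroup : ∀ a p x y → a + p + x + y ≡ a + y + (p + x)
  regroup = solve-∀

summand : ∀ d p r k n i → i ≤ p → p ≤ r → r ≤ k → suc d * k ≤ n →
  (((k ∸ r + p ∸ i) !) / ((k ∸ r) !)) {{(k ∸ r) !≢0}} * (p C i) * ((n ∸ r) C (i * d))
    * (((i * d) !) / ((d !) ^ i)) {{m^n≢0 (d !) i {{d !≢0}}}} * S (suc d) (r ∸ p) (n ∸ p ∸ i * d) (k ∸ i) * (k ∸ r) !
  ≡ (p C i) * (chooseBlocks d i (n ∸ r) * labelled (suc d) (r ∸ p) (k ∸ r + p ∸ i) (n ∸ r ∸ i * d))
summand d p r k n i i≤p p≤r r≤k sk≤n = begin
  falling * (p C i) * ((n ∸ r) C (i * d)) * multinomial * S′ * (k ∸ r) !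
    ≡⟨ regroup falling (p C i) ((n ∸ r) C (i * d)) multinomial S′ ((k ∸ r) !) ⟩
  (p C i) * (((n ∸ r) C (i * d)) * multinomial) * (S′ * (falling * (k ∸ r) !))
    ≡⟨ cong₂ (λ x y → (p C i) * x * (S′ * y)) blocks falling-factorial ⟩
  (p C i) * chooseBlocks d i (n ∸ r) * (S′ * b !)
    ≡⟨ cong ((p C i) * chooseBlocks d i (n ∸ r) *_) labelled-count ⟩
  (p C i) * chooseBlocks d i (n ∸ r) * labelled (suc d) (r ∸ p) b (n ∸ r ∸ i * d)
    ≡⟨ *-assoc (p C i) _ _ ⟩
  (p C i) * (chooseBlocks d i (n ∸ r) * labelled (suc d) (r ∸ p) b (n ∸ r ∸ i * d)) ∎
  where
  b = k ∸ r + p ∸ i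
  falling = ((b !) / ((k ∸ r) !)) {{(k ∸ r) !≢0}}
  multinomial = (((i * d) !) / ((d !) ^ i)) {{m^n≢0 (d !) i {{d !≢0}}}}
  S′ = S (suc d) (r ∸ p) (n ∸ p ∸ i * d) (k ∸ i)
  regroup : ∀ f c l m s x → f * c * l * m * s * x ≡ c * (l * m) * (s * (f * x))
  regroup = solve-∀
  r+i*d≤n : r + i * d ≤ n
  r+i*d≤n = ≤-trans (+-mono-≤ r≤k i*d≤d*k) sk≤n
    where
    i*d≤d*k : i * d ≤ d * k
    i*d≤d*k = subst (i * d ≤_) (*-comm k d) (*-monoˡ-≤ d (≤-trans i≤p (≤-trans p≤r r≤k)))
  falling-factorial : falling * (k ∸ r) ! ≡ b !
  falling-factorial = m/n*n≡m {{(k ∸ r) !≢0}} (m≤n⇒m!∣n! k∸r≤b)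
    where
    k∸r≤b : k ∸ r ≤ b
    k∸r≤b = subst (k ∸ r ≤_) (sym (+-∸-assoc (k ∸ r) i≤p)) (m≤m+n (k ∸ r) (p ∸ i))
  blocks : ((n ∸ r) C (i * d)) * multinomial ≡ chooseBlocks d i (n ∸ r)
  blocks = trans (cong (((n ∸ r) C (i * d)) *_) (multinomial≡chooseBlocks d i))
                 (chooseBlocks-split d i (n ∸ r) (m+n≤o⇒m≤o∸n (i * d) (subst (_≤ n) (+-comm r (i * d)) r+i*d≤n)))
  labelled-count : S′ * b ! ≡ labelled (suc d) (r ∸ p) b (n ∸ r ∸ i * d)
  labelled-count = begin
    S′ * b !
      ≡⟨ cong₂ (λ n′ k′ → S (suc d) (r ∸ p) n′ k′ * b !)
               (elements-left p≤r r+i*d≤n) (labels-left i≤p p≤r r≤k) ⟩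
    S (suc d) (r ∸ p) (r ∸ p + (n ∸ r ∸ i * d)) (r ∸ p + b) * b !
      ≡⟨ S-unlabel d (r ∸ p) b (n ∸ r ∸ i * d) ⟩
    labelled (suc d) (r ∸ p) b (n ∸ r ∸ i * d) ∎

mainTheorem12 : (s p r k n : ℕ) → 1 ≤ s → p ≤ r → r ≤ k → s * k ≤ n →
    S s r n k ≡
      sumTo p (λ i →
        (((k ∸ r + p ∸ i) !) / ((k ∸ r) !)) {{(k ∸ r) !≢0}}
        * (p C i)
        * ((n ∸ r) C (i * (s ∸ 1)))
        * (((i * (s ∸ 1)) !) / (((s ∸ 1) !) ^ i)) {{m^n≢0 ((s ∸ 1) !) i {{(s ∸ 1) !≢0}}}}
        * S s (r ∸ p) (n ∸ p ∸ i * (s ∸ 1)) (k ∸ i))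
mainTheorem12 (suc d) p r k n _ p≤r r≤k sk≤n = *-cancelʳ-≡ _ _ ((k ∸ r) !) {{(k ∸ r) !≢0}} (begin
  S s r n k * (k ∸ r) !
    ≡⟨ cong₂ (λ n′ k′ → S s r n′ k′ * (k ∸ r) !) (m+[n∸m]≡n r≤n) (m+[n∸m]≡n r≤k) ⟨
  S s r (r + (n ∸ r)) (r + (k ∸ r)) * (k ∸ r) !
    ≡⟨ S-unlabel d r (k ∸ r) (n ∸ r) ⟩
  labelled s r (k ∸ r) (n ∸ r)
    ≡⟨ cong (λ a → labelled s a (k ∸ r) (n ∸ r)) (m∸n+n≡m p≤r) ⟨
  labelled s (r ∸ p + p) (k ∸ r) (n ∸ r)
    ≡⟨ labelled-expand d p (r ∸ p) (k ∸ r) (n ∸ r) ⟩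
  ∑[ i ≤ p ] ((p C toℕ i)
               * (chooseBlocks d (toℕ i) (n ∸ r) * labelled s (r ∸ p) (k ∸ r + p ∸ toℕ i) (n ∸ r ∸ toℕ i * d)))
    ≡⟨ ∑-cong {suc p} (λ i → summand d p r k n (toℕ i) (≤-pred (toℕ<n i)) p≤r r≤k sk≤n) ⟨
  ∑[ i ≤ p ] (T (toℕ i) * (k ∸ r) !)
    ≡⟨ *-distribʳ-sum {suc p} ((k ∸ r) !) (λ i → T (toℕ i)) ⟨
  ∑[ i ≤ p ] T (toℕ i) * (k ∸ r) !
    ≡⟨ cong (_* (k ∸ r) !) (sumTo-∑ p T) ⟨
  sumTo p T * (k ∸ r) ! ∎)
  where
  s = suc d
  r≤n : r ≤ n
  r≤n = ≤-trans r≤k (≤-trans (m≤m+n k (d * k)) sk≤n)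
  T : ℕ → ℕ
  T i = (((k ∸ r + p ∸ i) !) / ((k ∸ r) !)) {{(k ∸ r) !≢0}} * (p C i) * ((n ∸ r) C (i * d))
        * (((i * d) !) / ((d !) ^ i)) {{m^n≢0 (d !) i {{d !≢0}}}} * S s (r ∸ p) (n ∸ p ∸ i * d) (k ∸ i)
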